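{- Let $G$ be a minimal non-DP-$4$-colorable graph. If $F$ is an induced subgraph of $G$ consisting of a cycle $x_1x_2\ldots x_mx_1$ together with $k\ge 0$ chords $x_1x_{i_1},x_1x_{i_2},\ldots,x_1x_{i_k}$ (and no other edges), then $d_G(x_1)\ge k+4$ or $d_G(x_i)\ge 5$ for some $i\in\{2,3,\ldots,m\}$.
   Context: Graphs are finite and simple. A $4$-assignment $L$ of $G$ assigns to each vertex $u$ a set $L(u)$ of $4$ colors. A cover $H$ of $G$ with assignment $L$ is a graph with vertex set $\{(u,c): u\in V(G), c\in L(u)\}$ such that $H[\{u\}\times L(u)]$ is complete for each $u$; for each edge $uv\in E(G)$ the edges of $H$ between $\{u\}\times L(u)$ and $\{v\}\times L(v)$ form a matching (possibly empty); and for $uv\notin E(G)$ there are no such edges. An $(H,L)$-coloring is an independent set of $H$ of size $|V(G)|$. $G$ is DP-$4$-colorable if it has an $(H,L)$-coloring for every $4$-assignment $L$ and every cover $H$. A minimal non-DP-$4$-colorable graph is a graph $G$ that is not DP-$4$-colorable but every proper subgraph of $G$ is DP-$4$-colorable. -}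

module Defs where

open import Data.Bool using (Bool; true; false; T; _∨_; _∧_; if_then_else_)
open import Data.Nat using (ℕ; zero; suc; _+_; _≤_; _≡ᵇ_)
open import Data.Fin using (Fin; toℕ)
open import Data.List using (List; map; allFin)
open import Data.Nat.ListAction using (sum)
open import Data.Product using (_×_; Σ; ∃; _,_)
open import Data.Sum using (_⊎_)
open import Relation.Nullary using (¬_)
open import Relation.Binary.PropositionalEquality using (_≡_; _≢_)
open import Function.Definitions using (Injective; Surjective)

record Graph (n : ℕ) : Set where
  field
    adj    : Fin n → Fin n → Bool
    sym    : ∀ u v → adj u v ≡ adj v u
    irrefl : ∀ u → adj u u ≡ false
open Graph public

count : ∀ {m} → (Fin m → Bool) → ℕ
count {m} p = sum (map (λ i → if p i then 1 else 0) (allFin m))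

deg : ∀ {n} → Graph n → Fin n → ℕ
deg G u = count (adj G u)

-- A 4-assignment L with cover H.  Since each L(u) has exactly 4 colours, we
-- index the colours of L(u) by Fin 4; the vertex (u , c) of H stands for
-- (u , the c-th colour of L(u)).  'cross u v c d' are the edges of H between
-- the fibres of u and v (u ≠ v).
record Cover {n : ℕ} (G : Graph n) : Set where
  field
    cross     : Fin n → Fin n → Fin 4 → Fin 4 → Bool
    cross-sym : ∀ u v c d → cross u v c d ≡ cross v u d c
    cross-adj : ∀ u v c d → T (cross u v c d) → T (adj G u v)
    match₁    : ∀ u v c d d' → T (cross u v c d) → T (cross u v c d') → d ≡ d'
    match₂    : ∀ u v c c' d → T (cross u v c d) → T (cross u v c' d) → c ≡ c'
open Cover public

HEdge : ∀ {n} {G : Graph n} → Cover G → (Fin n × Fin 4) → (Fin n × Fin 4) → Set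
HEdge H (u , c) (v , d) = ((u ≡ v) × (c ≢ d)) ⊎ T (cross H u v c d)

-- An (H,L)-colouring: an independent set of H of size |V(G)| = n,
-- given as an injective enumeration ι of its n elements.
Coloring : ∀ {n} {G : Graph n} → Cover G → Set
Coloring {n} H =
  Σ (Fin n → Fin n × Fin 4) λ ι →
    Injective _≡_ _≡_ ι × (∀ i j → i ≢ j → ¬ HEdge H (ι i) (ι j))

DP4Colorable : ∀ {n} → Graph n → Set
DP4Colorable G = (H : Cover G) → Coloring H

-- A subgraph of G (up to isomorphism): a graph F on Fin m with an injective
-- map f into V(G) sending edges of F to edges of G.
record Subgraph {n : ℕ} (G : Graph n) : Set where
  field
    m     : ℕ
    F     : Graph m
    f     : Fin m → Fin n
    f-inj : Injective _≡_ _≡_ f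
    f-hom : ∀ u v → T (adj F u v) → T (adj G (f u) (f v))
open Subgraph public

Proper : ∀ {n} {G : Graph n} → Subgraph G → Set
Proper {G = G} S =
  ¬ (Surjective _≡_ _≡_ (f S) ×
     (∀ u v → T (adj G (f S u) (f S v)) → T (adj (F S) u v)))

MinimalNonDP4 : ∀ {n} → Graph n → Set
MinimalNonDP4 G = ¬ DP4Colorable G × ((S : Subgraph G) → Proper S → DP4Colorable (F S))

-- cycle adjacency on indices 0..m-1 (0-based: index i is x_{i+1})
cycAdj : (m : ℕ) → Fin m → Fin m → Bool
cycAdj m i j =
  (suc (toℕ i) ≡ᵇ toℕ j) ∨ (suc (toℕ j) ≡ᵇ toℕ i) ∨
  ((suc (toℕ i) ≡ᵇ m) ∧ (toℕ j ≡ᵇ 0)) ∨ ((suc (toℕ j) ≡ᵇ m) ∧ (toℕ i ≡ᵇ 0))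

-- C marks the indices i such that x_1 x_i is a chord: i is neither x_1
-- (index 0) nor a cycle-neighbour of x_1.
ValidChords : (m : ℕ) → (Fin m → Bool) → Set
ValidChords m C = ∀ i j → toℕ j ≡ 0 → T (C i) → (toℕ i ≢ 0) × (cycAdj m i j ≡ false)

InducedCycleChords : ∀ {n} → Graph n → (m : ℕ) → (Fin m → Fin n) → (Fin m → Bool) → Set
InducedCycleChords G m x C =
  ∀ i j → adj G (x i) (x j) ≡
          (cycAdj m i j ∨ ((toℕ i ≡ᵇ 0) ∧ C j) ∨ ((toℕ j ≡ᵇ 0) ∧ C i))

module Submission where

-- Suppose d(x₀) ≤ k + 3 and d(x_i) ≤ 4 for i ≥ 1, and fix a cover H.
-- Deleting the edges inside the cycle leaves a proper subgraph, so by
-- minimality H has a colour function φ that is proper on every edge not inside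
-- the cycle (precolouring).  We recolour the cycle greedily.  Since x₀ has
-- k + 2 neighbours on the cycle, it has at most one outside neighbour, so
-- three of its colours are free.  Each of x₁, …, x_{m-2} has degree at most 4
-- and a still uncoloured neighbour, so some colour remains for it
-- (free-colour).  At most two colours of x_{m-1} are blocked from outside, and
-- a pigeonhole argument over the three free colours of x₀ yields a "good"
-- colour for x₀ that leaves x_{m-1} a colour whatever x_{m-2} receives.  The
-- result is a proper colour function, i.e. an (H,L)-colouring, so G would be
-- DP-4-colourable.

open import Defs hiding (sym)
open import Data.Bool using (Bool; true; false; T; _∨_; _∧_; not; if_then_else_)
open import Data.Bool.Properties using (T?; T-∨; T-∧; ∧-comm)
open import Data.Unit using (tt)
open import Data.Nat using (ℕ; zero; suc; _+_; _≤_; _<_; z≤n; s≤s; _≡ᵇ_)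
open import Data.Nat.Properties
  using (≤-trans; ≤-refl; ≤-reflexive; ≡⇒≡ᵇ; ≡ᵇ⇒≡; +-comm; _<?_; _≤?_; ≤∧≢⇒<; n<1+n; n≤1+n; <-trans; 1+n≰n)
  renaming (_≟_ to _≟ℕ_)
open import Data.Fin using (Fin; zero; suc; toℕ; punchOut; fromℕ<)
open import Data.Fin.Properties
  using (any?; all?; ¬∀⟶∃¬; punchOut-injective; injective⇒≤; toℕ-injective; toℕ-fromℕ<; toℕ<n)
  renaming (_≟_ to _≟F_)
open import Data.List using (List; []; _∷_; _++_; map; allFin; length; filterᵇ)
open import Data.List.Properties using (length-map; length-++)
open import Data.Nat.ListAction using (sum)
open import Data.List.Relation.Unary.All as All using (All; []; _∷_)
open import Data.List.Relation.Unary.All.Properties using (++⁺)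
open import Data.List.Relation.Unary.Any using (here; there)
open import Data.List.Relation.Unary.AllPairs using ([]; _∷_)
open import Data.List.Relation.Unary.Unique.Propositional using (Unique)
import Data.List.Relation.Unary.Unique.Propositional.Properties as Unique
open import Data.List.Relation.Binary.Subset.Propositional using (_⊆_)
open import Data.List.Membership.Propositional using (_∈_)
open import Data.List.Membership.Propositional.Properties using (∈-filter⁺; ∈-filter⁻; ∈-allFin; ∈-map⁻)
open import Data.Product using (_×_; Σ; ∃; ∃₂; _,_; proj₁; proj₂)
open import Data.Sum using (_⊎_; inj₁; inj₂)
open import Data.Empty using (⊥; ⊥-elim)
open import Function.Bundles using (Equivalence)
open import Relation.Nullary using (¬_; yes; no; ¬?; does)
open import Relation.Nullary.Decidable using (_×-dec_; _⊎-dec_; _→-dec_; decidable-stable)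
open import Relation.Unary using (Decidable)
open import Relation.Binary.Definitions using (DecidableEquality)
open import Relation.Binary.PropositionalEquality
  using (_≡_; _≢_; refl; sym; trans; cong; cong₂; subst; subst₂)
open import Function.Definitions using (Injective)

open Equivalence using (to)

-- Introduction rules for T of the Boolean connectives.  One operand is given
-- explicitly so that they apply to goals that are already partially evaluated.
T-∨ˡ : ∀ {a} b → T a → T (a ∨ b)
T-∨ˡ {true} b _ = tt

T-∨ʳ : ∀ a {b} → T b → T (a ∨ b)
T-∨ʳ true  _ = tt
T-∨ʳ false t = t

T-∧-intro : ∀ {a b} → T a → T b → T (a ∧ b)
T-∧-intro {true} _ t = t

sum-indicator≡length-filter : ∀ {A : Set} (p : A → Bool) (xs : List A) →
  sum (map (λ a → if p a then 1 else 0) xs) ≡ length (filterᵇ p xs)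
sum-indicator≡length-filter p [] = refl
sum-indicator≡length-filter p (a ∷ xs) with p a
... | true  = cong suc (sum-indicator≡length-filter p xs)
... | false = sum-indicator≡length-filter p xs

module _ {A : Set} (_≟_ : DecidableEquality A) where

  remove : A → List A → List A
  remove a [] = []
  remove a (b ∷ ys) with a ≟ b
  ... | yes _ = ys
  ... | no  _ = b ∷ remove a ys

  length-remove : ∀ {a} ys → a ∈ ys → suc (length (remove a ys)) ≡ length ys
  length-remove {a} (b ∷ ys) a∈ with a ≟ b | a∈
  ... | yes _   | _           = refl
  ... | no  a≢b | here a≡b    = ⊥-elim (a≢b a≡b)
  ... | no  _   | there a∈ys  = cong suc (length-remove ys a∈ys)

  ∈-remove : ∀ {a c} ys → c ∈ ys → a ≢ c → c ∈ remove a ys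
  ∈-remove {a} (b ∷ ys) c∈ a≢c with a ≟ b | c∈
  ... | yes refl | here refl  = ⊥-elim (a≢c refl)
  ... | yes _    | there c∈ys = c∈ys
  ... | no  _    | here c≡b   = here c≡b
  ... | no  _    | there c∈ys = there (∈-remove ys c∈ys a≢c)

  unique-⊆⇒length≤ : ∀ (xs ys : List A) → Unique xs → xs ⊆ ys → length xs ≤ length ys
  unique-⊆⇒length≤ [] ys _ _ = z≤n
  unique-⊆⇒length≤ (a ∷ xs) ys (a∉xs ∷ xs-unique) xs⊆ys =
    ≤-trans (s≤s (unique-⊆⇒length≤ xs (remove a ys) xs-unique
                    (λ c∈xs → ∈-remove ys (xs⊆ys (there c∈xs)) (All.lookup a∉xs c∈xs))))
            (≤-reflexive (length-remove ys (xs⊆ys (here refl))))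

length≤count : ∀ {m} (p : Fin m → Bool) (ws : List (Fin m)) → Unique ws →
               All (λ w → T (p w)) ws → length ws ≤ count p
length≤count {m} p ws ws-unique ws-sat =
  ≤-trans (unique-⊆⇒length≤ _≟F_ ws (filterᵇ p (allFin m)) ws-unique
             (λ {w} w∈ws → ∈-filter⁺ (λ w → T? (p w)) (∈-allFin w) (All.lookup ws-sat w∈ws)))
          (≤-reflexive (sym (sum-indicator≡length-filter p (allFin m))))

injective⇒surjective : ∀ {n} (f : Fin n → Fin n) → Injective _≡_ _≡_ f → ∀ u → ∃ λ i → f i ≡ u
injective⇒surjective {suc n} f f-inj u with any? (λ i → f i ≟F u)
... | yes hit = hit
... | no miss = ⊥-elim (1+n≰n (injective⇒≤ g-inj))
  where
  g : Fin (suc n) → Fin n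
  g i = punchOut {i = u} (λ u≡fi → miss (i , sym u≡fi))
  g-inj : Injective _≡_ _≡_ g
  g-inj {i} {j} gi≡gj =
    f-inj (punchOut-injective (λ e → miss (i , sym e)) (λ e → miss (j , sym e)) gi≡gj)

c0 c1 c2 c3 : Fin 4
c0 = zero
c1 = suc zero
c2 = suc (suc zero)
c3 = suc (suc (suc zero))

three-satisfy : (P : Fin 4 → Set) → Decidable P →
                (∀ a b → a ≢ b → ¬ P a → ¬ P b → ⊥) →
                Σ (Fin 4) λ a → Σ (Fin 4) λ b → Σ (Fin 4) λ c →
                  (a ≢ b × a ≢ c × b ≢ c) × P a × P b × P c
three-satisfy P P? one-fails with P? c0 | P? c1 | P? c2 | P? c3
... | yes p0 | yes p1 | yes p2 | _      = c0 , c1 , c2 , ((λ ()) , (λ ()) , (λ ())) , p0 , p1 , p2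
... | yes p0 | yes p1 | no  _  | yes p3 = c0 , c1 , c3 , ((λ ()) , (λ ()) , (λ ())) , p0 , p1 , p3
... | yes p0 | no  _  | yes p2 | yes p3 = c0 , c2 , c3 , ((λ ()) , (λ ()) , (λ ())) , p0 , p2 , p3
... | no  _  | yes p1 | yes p2 | yes p3 = c1 , c2 , c3 , ((λ ()) , (λ ()) , (λ ())) , p1 , p2 , p3
... | yes _  | yes _  | no  q2 | no  q3 = ⊥-elim (one-fails c2 c3 (λ ()) q2 q3)
... | yes _  | no  q1 | no  q2 | _      = ⊥-elim (one-fails c1 c2 (λ ()) q1 q2)
... | yes _  | no  q1 | yes _  | no  q3 = ⊥-elim (one-fails c1 c3 (λ ()) q1 q3)
... | no  q0 | no  q1 | _      | _      = ⊥-elim (one-fails c0 c1 (λ ()) q0 q1)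
... | no  q0 | yes _  | no  q2 | _      = ⊥-elim (one-fails c0 c2 (λ ()) q0 q2)
... | no  q0 | yes _  | yes _  | no  q3 = ⊥-elim (one-fails c0 c3 (λ ()) q0 q3)

AtMostTwo : (Fin 4 → Set) → Set
AtMostTwo O = ∀ a b c → a ≢ b → a ≢ c → b ≢ c → O a → O b → O c → ⊥

two-fail : (O : Fin 4 → Set) → Decidable O → AtMostTwo O →
           ∃₂ λ a b → a ≢ b × ¬ O a × ¬ O b
two-fail O O? two with O? c0 | O? c1 | O? c2 | O? c3
... | yes p0 | yes p1 | yes p2 | _      = ⊥-elim (two c0 c1 c2 (λ ()) (λ ()) (λ ()) p0 p1 p2)
... | yes p0 | yes p1 | no  _  | yes p3 = ⊥-elim (two c0 c1 c3 (λ ()) (λ ()) (λ ()) p0 p1 p3)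
... | yes _  | yes _  | no  q2 | no  q3 = c2 , c3 , (λ ()) , q2 , q3
... | yes p0 | no  _  | yes p2 | yes p3 = ⊥-elim (two c0 c2 c3 (λ ()) (λ ()) (λ ()) p0 p2 p3)
... | yes _  | no  q1 | yes _  | no  q3 = c1 , c3 , (λ ()) , q1 , q3
... | yes _  | no  q1 | no  q2 | _      = c1 , c2 , (λ ()) , q1 , q2
... | no  _  | yes p1 | yes p2 | yes p3 = ⊥-elim (two c1 c2 c3 (λ ()) (λ ()) (λ ()) p1 p2 p3)
... | no  q0 | yes _  | yes _  | no  q3 = c0 , c3 , (λ ()) , q0 , q3
... | no  q0 | yes _  | no  q2 | _      = c0 , c2 , (λ ()) , q0 , q2
... | no  q0 | no  q1 | _      | _      = c0 , c1 , (λ ()) , q0 , q1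

-- The pigeonhole step for the last cycle vertex.  Its colour d can be
-- excluded by outside neighbours (O, at most two colours), by the colour c of
-- x₁ (R c d, a matching: each d excluded by at most one c), or by the colour e
-- of its other cycle neighbour (S e d: each e excludes at most one d).
last-vertex-pigeonhole :
  (O : Fin 4 → Set) → Decidable O → AtMostTwo O →
  (R : Fin 4 → Fin 4 → Set) → (∀ c c' d → R c d → R c' d → c ≡ c') →
  (S : Fin 4 → Fin 4 → Set) → (∀ e d d' → S e d → S e d' → d ≡ d') →
  (a b c : Fin 4) → a ≢ b → a ≢ c → b ≢ c →
  (ea eb ec : Fin 4) →
  (∀ d → O d ⊎ R a d ⊎ S ea d) →
  (∀ d → O d ⊎ R b d ⊎ S eb d) →
  (∀ d → O d ⊎ R c d ⊎ S ec d) → ⊥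
last-vertex-pigeonhole O O? two R R-match S S-match a b c a≢b a≢c b≢c ea eb ec all-a all-b all-c
  with two-fail O O? two
... | u , v , u≢v , ¬Ou , ¬Ov = conclude (hits-u-or-v all-a) (hits-u-or-v all-b) (hits-u-or-v all-c)
  where
  -- each of a, b, c must exclude one of the two colours u, v through R
  hits-u-or-v : ∀ {k e} → (∀ d → O d ⊎ R k d ⊎ S e d) → R k u ⊎ R k v
  hits-u-or-v {k} {e} cover with cover u | cover v
  ... | inj₁ Ou          | _                 = ⊥-elim (¬Ou Ou)
  ... | _                | inj₁ Ov           = ⊥-elim (¬Ov Ov)
  ... | inj₂ (inj₁ Rku)  | _                 = inj₁ Rku
  ... | _                | inj₂ (inj₁ Rkv)   = inj₂ Rkv
  ... | inj₂ (inj₂ Seu)  | inj₂ (inj₂ Sev)   = ⊥-elim (u≢v (S-match e u v Seu Sev))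
  -- three colours, two targets: two of a, b, c hit the same one
  conclude : R a u ⊎ R a v → R b u ⊎ R b v → R c u ⊎ R c v → ⊥
  conclude (inj₁ Rau) (inj₁ Rbu) _          = a≢b (R-match a b u Rau Rbu)
  conclude (inj₂ Rav) (inj₂ Rbv) _          = a≢b (R-match a b v Rav Rbv)
  conclude (inj₁ Rau) _          (inj₁ Rcu) = a≢c (R-match a c u Rau Rcu)
  conclude (inj₂ Rav) _          (inj₂ Rcv) = a≢c (R-match a c v Rav Rcv)
  conclude _          (inj₁ Rbu) (inj₁ Rcu) = b≢c (R-match b c u Rbu Rcu)
  conclude _          (inj₂ Rbv) (inj₂ Rcv) = b≢c (R-match b c v Rbv Rcv)

-- The least colour with a decidable property (colour 0 if there is none).
choose : {P : Fin 4 → Set} → Decidable P → Fin 4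
choose P? with any? P?
... | yes (d , _) = d
... | no  _       = zero

choose-spec : {P : Fin 4 → Set} (P? : Decidable P) → ∃ P → P (choose P?)
choose-spec P? ex with any? P?
... | yes (_ , Pd) = Pd
... | no  none     = ⊥-elim (none ex)

-- A colour function κ picks the vertex (u , κ u) in every
-- fibre of a cover; it is proper when no two picked vertices are adjacent in
-- the cover.  Proper colour functions are exactly the (H,L)-colourings.

module _ {n : ℕ} {G : Graph n} (H : Cover G) where

  ProperColouring : (Fin n → Fin 4) → Set
  ProperColouring κ = ∀ u v → ¬ T (cross H u v (κ u) (κ v))

  proper⇒coloring : (κ : Fin n → Fin 4) → ProperColouring κ → Coloring H
  proper⇒coloring κ κ-proper = (λ u → u , κ u) , (λ e → cong proj₁ e) , independent
    where
    independent : ∀ u v → u ≢ v → ¬ HEdge H (u , κ u) (v , κ v)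
    independent u v u≢v (inj₁ (u≡v , _)) = u≢v u≡v
    independent u v u≢v (inj₂ clash)     = κ-proper u v clash

  -- An independent set of size n meets every fibre (the fibres are cliques,
  -- so it meets each at most once), hence reads off a proper colour function.
  coloring⇒proper : Coloring H → Σ (Fin n → Fin 4) ProperColouring
  coloring⇒proper (ι , ι-inj , independent) = κ , κ-proper
    where
    base-inj : Injective _≡_ _≡_ (λ i → proj₁ (ι i))
    base-inj {i} {j} same-base with i ≟F j
    ... | yes i≡j = i≡j
    ... | no  i≢j with proj₂ (ι i) ≟F proj₂ (ι j)
    ...   | yes same-colour = ⊥-elim (i≢j (ι-inj (cong₂ _,_ same-base same-colour)))
    ...   | no  other       = ⊥-elim (independent i j i≢j (inj₁ (same-base , other)))
    index : Fin n → Fin n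
    index u = proj₁ (injective⇒surjective _ base-inj u)
    κ : Fin n → Fin 4
    κ u = proj₂ (ι (index u))
    ι-index : ∀ u → ι (index u) ≡ (u , κ u)
    ι-index u = cong₂ _,_ (proj₂ (injective⇒surjective _ base-inj u)) refl
    κ-proper : ProperColouring κ
    κ-proper u v clash = independent (index u) (index v) index-distinct
        (subst₂ (HEdge H) (sym (ι-index u)) (sym (ι-index v)) (inj₂ clash))
      where
      index-distinct : index u ≢ index v
      index-distinct same with trans (sym (ι-index u)) (trans (cong ι same) (ι-index v))
      ... | refl = subst T (irrefl G u) (cross-adj H u u (κ u) (κ u) clash)

  Free : (Fin n → Fin 4) → (Fin n → Set) → Fin n → Fin 4 → Set
  Free κ S v d = ∀ w → S w → ¬ T (cross H v w d (κ w))

  module _ (κ : Fin n → Fin 4) {S : Fin n → Set} (S? : Decidable S) where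

    free? : ∀ v → Decidable (Free κ S v)
    free? v d = all? (λ w → S? w →-dec ¬? (T? (cross H v w d (κ w))))

    blocker : ∀ {v d} → ¬ Free κ S v d → ∃ λ w → S w × T (cross H v w d (κ w))
    blocker {v} {d} not-free
      with ¬∀⟶∃¬ n _ (λ w → S? w →-dec ¬? (T? (cross H v w d (κ w)))) not-free
    ... | w , fails with S? w | T? (cross H v w d (κ w))
    ...   | yes w∈S | yes clash = w , w∈S , clash
    ...   | no  w∉S | _         = ⊥-elim (fails (λ w∈S → ⊥-elim (w∉S w∈S)))
    ...   | yes _   | no  ok    = ⊥-elim (fails (λ _ → ok))

    Blocks : Fin n → List (Fin 4) → Fin n → Set
    Blocks v ds w = S w × ∃ λ d → d ∈ ds × T (cross H v w d (κ w))

    -- Distinct blocked colours are blocked by distinct vertices, since the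
    -- cover edges between two fibres form a matching.
    blocking-vertices : ∀ v (ds : List (Fin 4)) → Unique ds → All (λ d → ¬ Free κ S v d) ds →
      Σ (List (Fin n)) λ ws → length ws ≡ length ds × Unique ws × All (Blocks v ds) ws
    blocking-vertices v [] _ _ = [] , refl , [] , []
    blocking-vertices v (d ∷ ds) (d∉ds ∷ ds-unique) (not-free ∷ not-frees)
      with blocker not-free | blocking-vertices v ds ds-unique not-frees
    ... | w , w∈S , clash | ws , len , ws-unique , ws-block =
      w ∷ ws , cong suc len , All.map w-new ws-block ∷ ws-unique ,
      (w∈S , d , here refl , clash) ∷ All.map (λ { (s , d' , d'∈ , c) → s , d' , there d'∈ , c }) ws-block
      where
      w-new : ∀ {w'} → Blocks v ds w' → w ≢ w'
      w-new (_ , d' , d'∈ds , clash') refl =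
        All.lookup d∉ds d'∈ds (match₂ H v w d d' (κ w) clash clash')

    -- Every colour blocked at v costs v one neighbour in S; together with
    -- neighbours outside S this bounds the degree of v from below.
    blocked+outside≤deg : ∀ v (ds : List (Fin 4)) → Unique ds → All (λ d → ¬ Free κ S v d) ds →
      (us : List (Fin n)) → Unique us → All (λ u → T (adj G v u) × ¬ S u) us →
      length ds + length us ≤ deg G v
    blocked+outside≤deg v ds ds-unique not-frees us us-unique us-out
      with blocking-vertices v ds ds-unique not-frees
    ... | ws , len , ws-unique , ws-block =
      subst (_≤ deg G v) (trans (length-++ ws) (cong (_+ length us) len))
        (length≤count (adj G v) (ws ++ us)
          (Unique.++⁺ ws-unique us-unique disjoint)
          (++⁺ (All.map blocker-adjacent ws-block) (All.map proj₁ us-out)))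
      where
      disjoint : ∀ {w} → ¬ (w ∈ ws × w ∈ us)
      disjoint (w∈ws , w∈us) = proj₂ (All.lookup us-out w∈us) (proj₁ (All.lookup ws-block w∈ws))
      blocker-adjacent : ∀ {w} → Blocks v ds w → T (adj G v w)
      blocker-adjacent {w} (_ , d , _ , clash) = cross-adj H v w d (κ w) clash

    free-colour : ∀ {v u} → ¬ (5 ≤ deg G v) → T (adj G v u) → ¬ S u → ∃ (Free κ S v)
    free-colour {v} {u} low v~u u∉S with any? (free? v)
    ... | yes found = found
    ... | no  none  = ⊥-elim (low (blocked+outside≤deg v (allFin 4) (Unique.allFin⁺ 4)
                        (All.tabulate (λ {d} _ free → none (d , free)))
                        (u ∷ []) ([] ∷ []) ((v~u , u∉S) ∷ [])))

module DeleteInside {n : ℕ} (G : Graph n) {P : Fin n → Set} (P? : Decidable P) where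

  inside : Fin n → Fin n → Bool
  inside u v = does (P? u) ∧ does (P? v)

  adj∖P : Fin n → Fin n → Bool
  adj∖P u v = adj G u v ∧ not (inside u v)

  adj∖P-irrefl : ∀ u → adj∖P u u ≡ false
  adj∖P-irrefl u rewrite irrefl G u = refl

  G∖P : Graph n
  G∖P = record
    { adj    = adj∖P
    ; sym    = λ u v → cong₂ _∧_ (Graph.sym G u v) (cong not (∧-comm (does (P? u)) (does (P? v))))
    ; irrefl = adj∖P-irrefl
    }

  as-subgraph : Subgraph G
  as-subgraph = record
    { m = n ; F = G∖P ; f = λ u → u ; f-inj = λ e → e
    ; f-hom = λ u v uv → proj₁ (to (T-∧ {adj G u v}) uv)
    }

  proper-subgraph : ∀ {u v} → P u → P v → T (adj G u v) → Proper as-subgraph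
  proper-subgraph {u} {v} Pu Pv uv (_ , keeps-edges) with P? u | P? v | keeps-edges u v uv
  ... | yes _ | yes _ | kept = proj₂ (to (T-∧ {adj G u v}) kept)
  ... | no ¬Pu | _    | _    = ¬Pu Pu
  ... | yes _ | no ¬Pv | _   = ¬Pv Pv

  outside-edge : ∀ {u v} → ¬ (P u × P v) → T (not (inside u v))
  outside-edge {u} {v} not-inside with P? u | P? v
  ... | yes Pu | yes Pv = not-inside (Pu , Pv)
  ... | yes _  | no _   = tt
  ... | no _   | _      = tt

  restrict : Cover G → Cover G∖P
  restrict H = record
    { cross     = λ u v c d → cross H u v c d ∧ adj∖P u v
    ; cross-sym = λ u v c d → cong₂ _∧_ (cross-sym H u v c d) (Graph.sym G∖P u v)
    ; cross-adj = λ u v c d t → proj₂ (to (T-∧ {cross H u v c d}) t)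
    ; match₁    = λ u v c d d' t t' →
        match₁ H u v c d d' (proj₁ (to (T-∧ {cross H u v c d}) t)) (proj₁ (to (T-∧ {cross H u v c d'}) t'))
    ; match₂    = λ u v c c' d t t' →
        match₂ H u v c c' d (proj₁ (to (T-∧ {cross H u v c d}) t)) (proj₁ (to (T-∧ {cross H u v c' d}) t'))
    }

  proper-outside : (H : Cover G) (κ : Fin n → Fin 4) → ProperColouring (restrict H) κ →
                   ∀ u v → ¬ (P u × P v) → ¬ T (cross H u v (κ u) (κ v))
  proper-outside H κ κ-proper u v not-inside clash =
    κ-proper u v (T-∧-intro clash (T-∧-intro (cross-adj H u v (κ u) (κ v) clash) (outside-edge not-inside)))

precolouring : ∀ {n} (G : Graph n) → MinimalNonDP4 G →
               {P : Fin n → Set} → Decidable P → ∀ {u v} → P u → P v → T (adj G u v) →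
               (H : Cover G) →
               Σ (Fin n → Fin 4) λ κ → ∀ a b → ¬ (P a × P b) → ¬ T (cross H a b (κ a) (κ b))
precolouring {n} G (_ , minimal) P? Pu Pv uv H =
  proj₁ restricted , proper-outside H (proj₁ restricted) (proj₂ restricted)
  where
  open DeleteInside G P?
  restricted : Σ (Fin n → Fin 4) (ProperColouring (restrict H))
  restricted = coloring⇒proper (restrict H) (minimal as-subgraph (proper-subgraph Pu Pv uv) (restrict H))

module Configuration {n : ℕ} (G : Graph n) (p : ℕ)
  (x : Fin (3 + p) → Fin n) (x-inj : Injective _≡_ _≡_ x)
  (C : Fin (3 + p) → Bool) (chords : ValidChords (3 + p) C)
  (induced : InducedCycleChords G (3 + p) x C) where

  M : ℕ
  M = 3 + p

  x₀ : Fin n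
  x₀ = x zero

  OnCycle : Fin n → Set
  OnCycle w = ∃ λ i → x i ≡ w

  OnCycle? : Decidable OnCycle
  OnCycle? w = any? (λ i → x i ≟F w)

  at : ℕ → Fin M
  at k with k <? M
  ... | yes k<M = fromℕ< k<M
  ... | no  _   = zero

  toℕ-at : ∀ {k} → k < M → toℕ (at k) ≡ k
  toℕ-at {k} k<M with k <? M
  ... | yes k<M' = toℕ-fromℕ< k<M'
  ... | no  k≮M  = ⊥-elim (k≮M k<M)

  X : ℕ → Fin n
  X k = x (at k)

  x≡X : ∀ i → x i ≡ X (toℕ i)
  x≡X i = cong x (toℕ-injective (sym (toℕ-at (toℕ<n i))))

  X-on-cycle : ∀ k → OnCycle (X k)
  X-on-cycle k = at k , refl

  X-injective : ∀ {j k} → j < M → k < M → X j ≡ X k → j ≡ k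
  X-injective j<M k<M Xj≡Xk =
    trans (sym (toℕ-at j<M)) (trans (cong toℕ (x-inj Xj≡Xk)) (toℕ-at k<M))

  0<M : 0 < M
  0<M = s≤s z≤n

  1<M : 1 < M
  1<M = s≤s (s≤s z≤n)

  X₀ : X 0 ≡ x₀
  X₀ = cong x (toℕ-injective (toℕ-at 0<M))

  X-off-x₀ : ∀ {k} → suc k < M → X (suc k) ≢ x₀
  X-off-x₀ sk<M Xsk≡x₀ with X-injective sk<M 0<M (trans Xsk≡x₀ (sym X₀))
  ... | ()

  ℓ ℓ' : ℕ
  ℓ  = suc (suc p)
  ℓ' = suc p

  ℓ<M : ℓ < M
  ℓ<M = ≤-refl

  ℓ'<M : ℓ' < M
  ℓ'<M = n≤1+n ℓ

  last-position : ∀ {j} → suc j < M → ¬ (suc (suc j) < M) → j ≡ ℓ'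
  last-position {j} (s≤s (s≤s j≤ℓ')) ssj≮M with j ≟ℕ ℓ'
  ... | yes j≡ℓ' = j≡ℓ'
  ... | no  j≢ℓ' = ⊥-elim (ssj≮M (s≤s (s≤s (≤∧≢⇒< j≤ℓ' j≢ℓ'))))

  adj-sym : ∀ {u v} → T (adj G u v) → T (adj G v u)
  adj-sym {u} {v} uv = subst T (Graph.sym G u v) uv

  adj-from : ∀ a b → T (cycAdj M a b ∨ ((toℕ a ≡ᵇ 0) ∧ C b) ∨ ((toℕ b ≡ᵇ 0) ∧ C a)) →
             T (adj G (x a) (x b))
  adj-from a b = subst T (sym (induced a b))

  adj-next : ∀ {j} → suc j < M → T (adj G (X j) (X (suc j)))
  adj-next {j} sj<M = adj-from (at j) (at (suc j)) (T-∨ˡ _ (T-∨ˡ _ (≡⇒≡ᵇ _ _ consecutive)))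
    where
    consecutive : suc (toℕ (at j)) ≡ toℕ (at (suc j))
    consecutive = trans (cong suc (toℕ-at (<-trans (n<1+n j) sj<M))) (sym (toℕ-at sj<M))

  adj-close : T (adj G (X ℓ) x₀)
  adj-close = adj-from (at ℓ) zero
    (T-∨ˡ _ (T-∨ʳ (suc (toℕ (at ℓ)) ≡ᵇ 0) (T-∨ʳ (1 ≡ᵇ toℕ (at ℓ))
      (T-∨ˡ _ (T-∧-intro (≡⇒≡ᵇ _ M (cong suc (toℕ-at ℓ<M))) tt)))))

  adj-chord : ∀ i → T (C i) → T (adj G x₀ (x i))
  adj-chord i chord = adj-from zero i (T-∨ʳ (cycAdj M zero i) (T-∨ˡ _ chord))

  adj-cases : ∀ a b → T (adj G (x a) (x b)) →
              toℕ a ≡ 0 ⊎ toℕ b ≡ 0 ⊎ suc (toℕ a) ≡ toℕ b ⊎ suc (toℕ b) ≡ toℕ a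
  adj-cases a b ab with to (T-∨ {cycAdj M a b}) (subst T (induced a b) ab)
  ... | inj₂ chord with to (T-∨ {(toℕ a ≡ᵇ 0) ∧ C b}) chord
  ...   | inj₁ at-a = inj₁ (≡ᵇ⇒≡ _ _ (proj₁ (to (T-∧ {toℕ a ≡ᵇ 0}) at-a)))
  ...   | inj₂ at-b = inj₂ (inj₁ (≡ᵇ⇒≡ _ _ (proj₁ (to (T-∧ {toℕ b ≡ᵇ 0}) at-b))))
  adj-cases a b ab | inj₁ cyc with to (T-∨ {suc (toℕ a) ≡ᵇ toℕ b}) cyc
  ... | inj₁ a→b = inj₂ (inj₂ (inj₁ (≡ᵇ⇒≡ _ _ a→b)))
  ... | inj₂ cyc' with to (T-∨ {suc (toℕ b) ≡ᵇ toℕ a}) cyc'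
  ...   | inj₁ b→a = inj₂ (inj₂ (inj₂ (≡ᵇ⇒≡ _ _ b→a)))
  ...   | inj₂ wrap with to (T-∨ {(suc (toℕ a) ≡ᵇ M) ∧ (toℕ b ≡ᵇ 0)}) wrap
  ...     | inj₁ a-last = inj₂ (inj₁ (≡ᵇ⇒≡ _ _ (proj₂ (to (T-∧ {suc (toℕ a) ≡ᵇ M}) a-last))))
  ...     | inj₂ b-last = inj₁ (≡ᵇ⇒≡ _ _ (proj₂ (to (T-∧ {suc (toℕ b) ≡ᵇ M}) b-last)))

  adj-positions : ∀ {j k} → j < M → k < M → T (adj G (X j) (X k)) →
                  j ≡ 0 ⊎ k ≡ 0 ⊎ suc j ≡ k ⊎ suc k ≡ j
  adj-positions {j} {k} j<M k<M XjXk with adj-cases (at j) (at k) XjXk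
  ... | inj₁ e                 = inj₁ (trans (sym (toℕ-at j<M)) e)
  ... | inj₂ (inj₁ e)          = inj₂ (inj₁ (trans (sym (toℕ-at k<M)) e))
  ... | inj₂ (inj₂ (inj₁ e))   =
    inj₂ (inj₂ (inj₁ (trans (cong suc (sym (toℕ-at j<M))) (trans e (toℕ-at k<M)))))
  ... | inj₂ (inj₂ (inj₂ e))   =
    inj₂ (inj₂ (inj₂ (trans (cong suc (sym (toℕ-at k<M))) (trans e (toℕ-at j<M)))))

  chord-ends : List (Fin n)
  chord-ends = map x (filterᵇ C (allFin M))

  chord-end : ∀ {w} → w ∈ chord-ends → ∃ λ i → T (C i) × w ≡ x i
  chord-end w∈ with ∈-map⁻ x w∈
  ... | i , i∈ , w≡xi = i , proj₂ (∈-filter⁻ (λ k → T? (C k)) i∈) , w≡xi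

  chord-ends-unique : Unique chord-ends
  chord-ends-unique = Unique.map⁺ x-inj (Unique.filter⁺ (λ k → T? (C k)) (Unique.allFin⁺ M))

  chord-ends-length : length chord-ends ≡ count C
  chord-ends-length =
    trans (length-map x (filterᵇ C (allFin M))) (sym (sum-indicator≡length-filter C (allFin M)))

  chord-not-1 : ∀ i → T (C i) → toℕ i ≢ 1
  chord-not-1 i chord i≡1 = subst T (proj₂ (chords i zero refl chord))
    (T-∨ʳ (suc (toℕ i) ≡ᵇ 0) (T-∨ˡ _ (≡⇒≡ᵇ 1 (toℕ i) (sym i≡1))))

  chord-not-ℓ : ∀ i → T (C i) → toℕ i ≢ ℓ
  chord-not-ℓ i chord i≡ℓ = subst T (proj₂ (chords i zero refl chord))
    (T-∨ʳ (suc (toℕ i) ≡ᵇ 0) (T-∨ʳ (1 ≡ᵇ toℕ i)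
      (T-∨ˡ _ (T-∧-intro (≡⇒≡ᵇ (suc (toℕ i)) M (cong suc i≡ℓ)) tt))))

  X-not-chord-end : ∀ {k} → k < M → (∀ i → T (C i) → toℕ i ≢ k) → ∀ {w} → w ∈ chord-ends → X k ≢ w
  X-not-chord-end k<M not-chord w∈ Xk≡w with chord-end w∈
  ... | i , chord , w≡xi = not-chord i chord (trans (cong toℕ (sym (x-inj (trans Xk≡w w≡xi)))) (toℕ-at k<M))

  module Extension
    (x₀-low : ¬ (count C + 4 ≤ deg G x₀))
    (rest-low : ∀ i → toℕ i ≢ 0 → ¬ (5 ≤ deg G (x i)))
    (H : Cover G) (φ : Fin n → Fin 4)
    (φ-outside : ∀ u v → ¬ (OnCycle u × OnCycle v) → ¬ T (cross H u v (φ u) (φ v)))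
    where

    Outside : Fin n → Set
    Outside w = ¬ OnCycle w

    Outside? : Decidable Outside
    Outside? w = ¬? (OnCycle? w)

    X-low : ∀ {k} → suc k < M → ¬ (5 ≤ deg G (X (suc k)))
    X-low {k} sk<M = rest-low (at (suc k)) (λ at≡0 → 0≢suc (trans (sym at≡0) (toℕ-at sk<M)))
      where
      0≢suc : 0 ≢ suc k
      0≢suc ()

    FreeOut : Fin n → Fin 4 → Set
    FreeOut = Free H φ Outside

    -- x₀ already has count C + 2 neighbours on the cycle (X 1, X ℓ and the
    -- chord ends), so at most one outside neighbour: at most one colour of x₀
    -- is blocked from outside.
    x₀-blocked-at-most-once : ∀ a b → a ≢ b → ¬ FreeOut x₀ a → ¬ FreeOut x₀ b → ⊥
    x₀-blocked-at-most-once a b a≢b a-blocked b-blocked =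
      x₀-low (subst (_≤ deg G x₀) size
        (blocked+outside≤deg H φ Outside? x₀ (a ∷ b ∷ []) ((a≢b ∷ []) ∷ [] ∷ [])
          (a-blocked ∷ b-blocked ∷ []) cycle-neighbours distinct cycle-adjacent))
      where
      cycle-neighbours : List (Fin n)
      cycle-neighbours = X 1 ∷ X ℓ ∷ chord-ends
      size : 2 + length cycle-neighbours ≡ count C + 4
      size = trans (cong (4 +_) chord-ends-length) (+-comm 4 (count C))
      distinct : Unique cycle-neighbours
      distinct = (X1≢Xℓ ∷ All.tabulate (X-not-chord-end 1<M chord-not-1))
               ∷ All.tabulate (X-not-chord-end ℓ<M chord-not-ℓ)
               ∷ chord-ends-unique
        where
        X1≢Xℓ : X 1 ≢ X ℓ
        X1≢Xℓ X1≡Xℓ with X-injective 1<M ℓ<M X1≡Xℓ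
        ... | ()
      on-cycle : ∀ {w} → OnCycle w → ¬ Outside w
      on-cycle on out = out on
      cycle-adjacent : All (λ u → T (adj G x₀ u) × ¬ Outside u) cycle-neighbours
      cycle-adjacent = (subst (λ v → T (adj G v (X 1))) X₀ (adj-next 1<M) , on-cycle (X-on-cycle 1))
                     ∷ (adj-sym adj-close , on-cycle (X-on-cycle ℓ))
                     ∷ All.tabulate chord-adjacent
        where
        chord-adjacent : ∀ {w} → w ∈ chord-ends → T (adj G x₀ w) × ¬ Outside w
        chord-adjacent w∈ with chord-end w∈
        ... | i , chord , refl = adj-chord i chord , on-cycle (i , refl)

    -- X ℓ has the two cycle neighbours x₀ and X ℓ' and degree at most 4, so at
    -- most two of its colours are blocked from outside.
    Xℓ-blocked-at-most-twice : AtMostTwo (λ d → ¬ FreeOut (X ℓ) d)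
    Xℓ-blocked-at-most-twice a b c a≢b a≢c b≢c a-blocked b-blocked c-blocked =
      X-low ℓ<M
        (blocked+outside≤deg H φ Outside? (X ℓ) (a ∷ b ∷ c ∷ []) ((a≢b ∷ a≢c ∷ []) ∷ (b≢c ∷ []) ∷ [] ∷ [])
          (a-blocked ∷ b-blocked ∷ c-blocked ∷ [])
          (x₀ ∷ X ℓ' ∷ []) ((x₀≢Xℓ' ∷ []) ∷ [] ∷ [])
          ((adj-close , λ out → out (zero , refl)) ∷ (adj-sym (adj-next ℓ<M) , λ out → out (X-on-cycle ℓ')) ∷ []))
      where
      x₀≢Xℓ' : x₀ ≢ X ℓ'
      x₀≢Xℓ' x₀≡Xℓ' = X-off-x₀ ℓ'<M (sym x₀≡Xℓ')

    -- The colour function seen by the next vertex of the greedy colouring: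
    -- φ, except that x₀ has colour c₀ and the previous vertex u colour e.
    recolour : Fin 4 → Fin n → Fin 4 → Fin n → Fin 4
    recolour c₀ u e w with w ≟F x₀
    ... | yes _ = c₀
    ... | no  _ with w ≟F u
    ...   | yes _ = e
    ...   | no  _ = φ w

    recolour-x₀ : ∀ c₀ u e → recolour c₀ u e x₀ ≡ c₀
    recolour-x₀ c₀ u e with x₀ ≟F x₀
    ... | yes _    = refl
    ... | no  x₀≢x₀ = ⊥-elim (x₀≢x₀ refl)

    recolour-u : ∀ c₀ u e → (u ≡ x₀ → e ≡ c₀) → recolour c₀ u e u ≡ e
    recolour-u c₀ u e consistent with u ≟F x₀
    ... | yes u≡x₀ = sym (consistent u≡x₀)
    ... | no  _ with u ≟F u
    ...   | yes _   = refl
    ...   | no  u≢u = ⊥-elim (u≢u refl)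

    recolour-outside : ∀ c₀ u e w → Outside w → OnCycle u → recolour c₀ u e w ≡ φ w
    recolour-outside c₀ u e w out u-on with w ≟F x₀
    ... | yes refl = ⊥-elim (out (zero , refl))
    ... | no  _ with w ≟F u
    ...   | yes refl = ⊥-elim (out u-on)
    ...   | no  _    = refl

    Known : Fin n → Fin n → Set
    Known u w = Outside w ⊎ w ≡ x₀ ⊎ w ≡ u

    Known? : ∀ u → Decidable (Known u)
    Known? u w = Outside? w ⊎-dec (w ≟F x₀) ⊎-dec (w ≟F u)

    Fits : Fin n → Fin 4 → Fin n → Fin 4 → Fin 4 → Set
    Fits v c₀ u e = Free H (recolour c₀ u e) (Known u) v

    fits? : ∀ v c₀ u e → Decidable (Fits v c₀ u e)
    fits? v c₀ u e = free? H (recolour c₀ u e) (Known? u) v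

    -- An inner vertex X (suc j) has the uncoloured neighbour X (suc (suc j)),
    -- so by the greedy step it has a fitting colour.
    inner-fits : ∀ {j} → suc (suc j) < M → ∀ c₀ e → ∃ (Fits (X (suc j)) c₀ (X j) e)
    inner-fits {j} ssj<M c₀ e =
      free-colour H (recolour c₀ (X j) e) (Known? (X j)) (X-low sj<M) (adj-next ssj<M) unknown
      where
      sj<M : suc j < M
      sj<M = <-trans (n<1+n (suc j)) ssj<M
      unknown : ¬ Known (X j) (X (suc (suc j)))
      unknown (inj₁ out)              = out (X-on-cycle (suc (suc j)))
      unknown (inj₂ (inj₁ is-x₀))     = X-off-x₀ ssj<M is-x₀
      unknown (inj₂ (inj₂ is-prev)) with X-injective ssj<M (<-trans (n<1+n j) sj<M) is-prev
      ... | ()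

    Good : Fin 4 → Set
    Good c₀ = FreeOut x₀ c₀ × (∀ e → ∃ (Fits (X ℓ) c₀ (X ℓ') e))

    Good? : Decidable Good
    Good? c₀ = free? H φ Outside? x₀ c₀ ×-dec all? (λ e → any? (fits? (X ℓ) c₀ (X ℓ') e))

    not-good⇒excluded : ∀ c → FreeOut x₀ c → ¬ Good c →
      ∃ λ e → ∀ d → ¬ FreeOut (X ℓ) d ⊎ T (cross H (X ℓ) x₀ d c) ⊎ T (cross H (X ℓ) (X ℓ') d e)
    not-good⇒excluded c c-free not-good
      with ¬∀⟶∃¬ 4 _ (λ e → any? (fits? (X ℓ) c (X ℓ') e)) (λ all-fit → not-good (c-free , all-fit))
    ... | e , none-fits = e , excluded
      where
      excluded : ∀ d → ¬ FreeOut (X ℓ) d ⊎ T (cross H (X ℓ) x₀ d c) ⊎ T (cross H (X ℓ) (X ℓ') d e)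
      excluded d with blocker H (recolour c (X ℓ') e) (Known? (X ℓ')) (λ fits → none-fits (d , fits))
      ... | w , inj₁ out , clash = inj₁ (λ free → free w out
              (subst (λ k → T (cross H (X ℓ) w d k)) (recolour-outside c (X ℓ') e w out (X-on-cycle ℓ')) clash))
      ... | w , inj₂ (inj₁ refl) , clash = inj₂ (inj₁
              (subst (λ k → T (cross H (X ℓ) x₀ d k)) (recolour-x₀ c (X ℓ') e) clash))
      ... | w , inj₂ (inj₂ refl) , clash = inj₂ (inj₂
              (subst (λ k → T (cross H (X ℓ) (X ℓ') d k))
                (recolour-u c (X ℓ') e (λ is-x₀ → ⊥-elim (X-off-x₀ ℓ'<M is-x₀))) clash))

    -- A good colour exists: three colours of x₀ are free from outside, and
    -- by the pigeonhole step they cannot all fail to be good.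
    not-all-bad : ¬ (∀ c → ¬ Good c)
    not-all-bad all-bad = refute (three-satisfy (FreeOut x₀) (free? H φ Outside? x₀) x₀-blocked-at-most-once)
      where
      excluded : ∀ c → FreeOut x₀ c → ∃ λ e → ∀ d →
                 ¬ FreeOut (X ℓ) d ⊎ T (cross H (X ℓ) x₀ d c) ⊎ T (cross H (X ℓ) (X ℓ') d e)
      excluded c c-free = not-good⇒excluded c c-free (all-bad c)
      refute : (Σ (Fin 4) λ a → Σ (Fin 4) λ b → Σ (Fin 4) λ c →
                 (a ≢ b × a ≢ c × b ≢ c) × FreeOut x₀ a × FreeOut x₀ b × FreeOut x₀ c) → ⊥
      refute (a , b , c , (a≢b , a≢c , b≢c) , a-free , b-free , c-free) =
        last-vertex-pigeonhole
          (λ d → ¬ FreeOut (X ℓ) d) (λ d → ¬? (free? H φ Outside? (X ℓ) d)) Xℓ-blocked-at-most-twice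
          (λ c d → T (cross H (X ℓ) x₀ d c)) (λ c c' d → match₁ H (X ℓ) x₀ d c c')
          (λ e d → T (cross H (X ℓ) (X ℓ') d e)) (λ e d d' → match₂ H (X ℓ) (X ℓ') d d' e)
          a b c a≢b a≢c b≢c
          (proj₁ (excluded a a-free)) (proj₁ (excluded b b-free)) (proj₁ (excluded c c-free))
          (proj₂ (excluded a a-free)) (proj₂ (excluded b b-free)) (proj₂ (excluded c c-free))

    -- (opaque: the colouring below only uses the goodness of c₀, and unfolding
    -- the decision procedure in types is costly)
    opaque
      good-colour : ∃ Good
      good-colour = decidable-stable (any? Good?) (λ none → not-all-bad (λ c good → none (c , good)))

    c₀ : Fin 4
    c₀ = proj₁ good-colour

    colour : ℕ → Fin 4
    colour zero    = c₀
    colour (suc j) = choose (fits? (X (suc j)) c₀ (X j) (colour j))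

    -- Inner vertices fit by the greedy step, the last one since c₀ is good.
    colour-fits : ∀ {j} → suc j < M → Fits (X (suc j)) c₀ (X j) (colour j) (colour (suc j))
    colour-fits {j} sj<M = choose-spec (fits? (X (suc j)) c₀ (X j) (colour j)) fitting
      where
      fitting : ∃ (Fits (X (suc j)) c₀ (X j) (colour j))
      fitting with suc (suc j) <? M
      ... | yes ssj<M = inner-fits ssj<M c₀ (colour j)
      ... | no  ssj≮M with last-position sj<M ssj≮M
      ...   | refl = proj₂ (proj₂ good-colour) (colour ℓ')

    colour-x₀ : ∀ {j} → j < M → X j ≡ x₀ → colour j ≡ c₀
    colour-x₀ {zero}  _     _    = refl
    colour-x₀ {suc j} sj<M is-x₀ = ⊥-elim (X-off-x₀ sj<M is-x₀)

    clear-of-outside : ∀ {k} → k < M → ∀ w → Outside w → ¬ T (cross H (X k) w (colour k) (φ w))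
    clear-of-outside {zero} _ w out clash =
      proj₁ (proj₂ good-colour) w out (subst (λ v → T (cross H v w c₀ (φ w))) X₀ clash)
    clear-of-outside {suc j} sj<M w out clash =
      colour-fits sj<M w (inj₁ out)
        (subst (λ k → T (cross H (X (suc j)) w (colour (suc j)) k))
          (sym (recolour-outside c₀ (X j) (colour j) w out (X-on-cycle j))) clash)

    clear-of-x₀ : ∀ {j} → suc j < M → ¬ T (cross H (X (suc j)) x₀ (colour (suc j)) c₀)
    clear-of-x₀ {j} sj<M clash =
      colour-fits sj<M x₀ (inj₂ (inj₁ refl))
        (subst (λ k → T (cross H (X (suc j)) x₀ (colour (suc j)) k)) (sym (recolour-x₀ c₀ (X j) (colour j))) clash)

    clear-of-previous : ∀ {j} → suc j < M → ¬ T (cross H (X (suc j)) (X j) (colour (suc j)) (colour j))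
    clear-of-previous {j} sj<M clash =
      colour-fits sj<M (X j) (inj₂ (inj₂ refl))
        (subst (λ k → T (cross H (X (suc j)) (X j) (colour (suc j)) k))
          (sym (recolour-u c₀ (X j) (colour j) (colour-x₀ (<-trans (n<1+n j) sj<M)))) clash)

    flip : ∀ {u v c d} → T (cross H u v c d) → T (cross H v u d c)
    flip {u} {v} {c} {d} = subst T (cross-sym H u v c d)

    -- Every edge of the configuration joins x₀ to another vertex or two
    -- consecutive vertices, and these were kept apart at the later endpoint.
    cycle-proper : ∀ {j k} → j < M → k < M → T (adj G (X j) (X k)) →
                   ¬ T (cross H (X j) (X k) (colour j) (colour k))
    cycle-proper {zero} {zero} _ _ loop _ = subst T (irrefl G (X 0)) loop
    cycle-proper {zero} {suc k} _ sk<M _ clash =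
      clear-of-x₀ sk<M (subst (λ v → T (cross H (X (suc k)) v (colour (suc k)) c₀)) X₀ (flip clash))
    cycle-proper {suc j} {zero} sj<M _ _ clash =
      clear-of-x₀ sj<M (subst (λ v → T (cross H (X (suc j)) v (colour (suc j)) c₀)) X₀ clash)
    cycle-proper {suc j} {suc k} sj<M sk<M edge clash with adj-positions sj<M sk<M edge
    ... | inj₁ ()
    ... | inj₂ (inj₁ ())
    ... | inj₂ (inj₂ (inj₁ refl)) = clear-of-previous sk<M (flip clash)
    ... | inj₂ (inj₂ (inj₂ refl)) = clear-of-previous sj<M clash

    -- The final colour function: the greedy colours on the cycle, φ elsewhere.
    -- (opaque: ψ is used only through ψ-on and ψ-off)
    opaque
      ψ : Fin n → Fin 4
      ψ w with OnCycle? w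
      ... | yes (i , _) = colour (toℕ i)
      ... | no  _       = φ w

      ψ-on : ∀ i → ψ (x i) ≡ colour (toℕ i)
      ψ-on i with OnCycle? (x i)
      ... | yes (i' , xi'≡xi) = cong (λ k → colour (toℕ k)) (x-inj xi'≡xi)
      ... | no  off           = ⊥-elim (off (i , refl))

      ψ-off : ∀ w → Outside w → ψ w ≡ φ w
      ψ-off w out with OnCycle? w
      ... | yes on = ⊥-elim (out on)
      ... | no  _  = refl

    cycle-outside-proper : ∀ i w → Outside w → ¬ T (cross H (x i) w (ψ (x i)) (ψ w))
    cycle-outside-proper i w out clash = clear-of-outside (toℕ<n i) w out
      (subst₂ (λ v k → T (cross H v w (colour (toℕ i)) k)) (x≡X i) (ψ-off w out)
        (subst (λ k → T (cross H (x i) w k (ψ w))) (ψ-on i) clash))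

    ψ-proper : ProperColouring H ψ
    ψ-proper u v clash with OnCycle? u | OnCycle? v
    ... | yes (i , refl) | yes (k , refl) =
      cycle-proper (toℕ<n i) (toℕ<n k) (subst₂ (λ a b → T (adj G a b)) (x≡X i) (x≡X k) edge)
        (subst₂ (λ a b → T (cross H a b (colour (toℕ i)) (colour (toℕ k)))) (x≡X i) (x≡X k)
          (subst₂ (λ a b → T (cross H (x i) (x k) a b)) (ψ-on i) (ψ-on k) clash))
      where
      edge : T (adj G (x i) (x k))
      edge = cross-adj H (x i) (x k) (ψ (x i)) (ψ (x k)) clash
    ... | yes (i , refl) | no  v-out = cycle-outside-proper i v v-out clash
    ... | no  u-out | yes (k , refl) = cycle-outside-proper k u u-out (flip clash)
    ... | no  u-out | no  v-out      = φ-outside u v (λ { (on , _) → u-out on })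
      (subst₂ (λ a b → T (cross H u v a b)) (ψ-off u u-out) (ψ-off v v-out) clash)

    coloring : Coloring H
    coloring = proper⇒coloring H ψ ψ-proper

lemma3 : ∀ {n} (G : Graph n) → MinimalNonDP4 G →
         (m : ℕ) → 3 ≤ m →
         (x : Fin m → Fin n) → Injective _≡_ _≡_ x →
         (C : Fin m → Bool) → ValidChords m C →
         InducedCycleChords G m x C →
         (x₁ : Fin m) → toℕ x₁ ≡ 0 →
         (count C + 4 ≤ deg G (x x₁)) ⊎ (∃ λ i → (toℕ i ≢ 0) × (5 ≤ deg G (x i)))
lemma3 G minimal (suc (suc (suc p))) (s≤s (s≤s (s≤s z≤n))) x x-inj C chords induced x₁ x₁≡0
  with toℕ-injective {i = x₁} {j = zero} x₁≡0
... | refl with count C + 4 ≤? deg G (x zero)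
...   | yes x₀-high = inj₁ x₀-high
...   | no  x₀-low with any? (λ i → ¬? (toℕ i ≟ℕ 0) ×-dec (5 ≤? deg G (x i)))
...     | yes other-high = inj₂ other-high
...     | no  rest-low = ⊥-elim (proj₁ minimal λ H → extend H
            (precolouring G minimal OnCycle? (X-on-cycle 0) (X-on-cycle 1) (adj-next 1<M) H))
  where
  open Configuration G p x x-inj C chords induced
  extend : (H : Cover G) →
           (Σ (Fin _ → Fin 4) λ φ → ∀ u v → ¬ (OnCycle u × OnCycle v) → ¬ T (cross H u v (φ u) (φ v))) →
           Coloring H
  extend H (φ , φ-outside) =
    Extension.coloring x₀-low (λ i i≢0 high → rest-low (i , i≢0 , high)) H φ φ-outside
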